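{- Let $p$ be an odd Ramanujan prime, and write $p=p_n$. Then every integer $k$ with $\frac{p_n+1}{2}\le k\le \frac{p_{n+1}-1}{2}$ is composite; equivalently, if $m$ is the index with $p_m<p/2<p_{m+1}$, then the open interval $(p,\,2p_{m+1})$ contains a prime.
   Context: $p_j$ denotes the $j$-th prime ($p_1=2$), and $\pi(x)$ the number of primes $\le x$ for real $x$. For $n\ge 1$, the $n$-th Ramanujan prime $R_n$ is the smallest positive integer such that $\pi(x)-\pi(x/2)\ge n$ for every real $x\ge R_n$ (these are $2,11,17,29,41,\dots$). A Ramanujan prime is any $R_n$. -}

module Defs where

open import Data.Nat using (ℕ; suc; _+_; _/_; _%_; _≤_; _<_)
open import Data.Nat.Primality using (Prime; prime?)
open import Data.List using (length; filter; upTo)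
open import Data.Product using (_×_; ∃-syntax)
open import Relation.Binary.PropositionalEquality using (_≡_)
open import Relation.Nullary using (¬_)

primePi : ℕ → ℕ
primePi x = length (filter prime? (upTo (suc x)))

-- "p is the j-th prime" (p_1 = 2): p is prime and exactly j primes are ≤ p.
IsNthPrime : ℕ → ℕ → Set
IsNthPrime j p = Prime p × primePi p ≡ j

-- For real x ≥ 0 one has
-- π(x) = π(⌊x⌋) and π(x/2) = π(⌊⌊x⌋/2⌋), so quantifying over all
-- reals x ≥ r (r a positive integer) is the same as over naturals x ≥ r.
RamanujanCond : ℕ → ℕ → Set
RamanujanCond n x = n + primePi (x / 2) ≤ primePi x

GoodFrom : ℕ → ℕ → Set
GoodFrom n r = ∀ x → r ≤ x → RamanujanCond n x

IsRamanujan : ℕ → ℕ → Set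
IsRamanujan n R = 1 ≤ R × GoodFrom n R × (∀ r → 1 ≤ r → r < R → ¬ GoodFrom n r)

IsRamanujanPrime : ℕ → Set
IsRamanujanPrime p = ∃[ n ] (1 ≤ n × IsRamanujan n p)

Odd : ℕ → Set
Odd p = p % 2 ≡ 1

{-# OPTIONS --safe #-}
-- Write p = 2t + 1 = R_m. Minimality of R_m means the Ramanujan condition fails at
-- x = 2t, i.e. π(p) - 1 - π(t) < m, so π(p) ≤ m + π(t). If some prime k had
-- t < k and 2k < p_{n+1}, then p ≤ 2k forces π(2k) = π(p), and the condition at
-- x = 2k ≥ R_m gives m + π(k) ≤ π(p) ≤ m + π(t), contradicting π(t) < π(k).
module Submission where

open import Defs
open import Data.Nat using (ℕ; zero; suc; _+_; _*_; _∸_; _/_; _≤_; _<_; z<s; s≤s; s≤s⁻¹; n>1⇒nonTrivial)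
open import Data.Nat.Properties
open import Data.Nat.DivMod using (m≡m%n+[m/n]*n; m*n/n≡m; m/n*n≤m)
open import Data.Nat.Primality using (Composite; Prime; prime?; ¬prime⇒composite)
open import Data.List using ([_]; length; filter; upTo; _++_)
open import Data.List.Properties using (upTo-∷ʳ; filter-++; length-++)
open import Data.Product using (_,_)
open import Data.Sum using (inj₁; inj₂)
open import Relation.Binary.PropositionalEquality hiding ([_])
open import Relation.Nullary using (¬_; yes; no; contradiction)

primePi-suc : ∀ x → primePi (suc x) ≡ primePi x + length (filter prime? [ suc x ])
primePi-suc x = begin
    length (filter prime? (upTo (suc (suc x))))
  ≡⟨ cong (λ l → length (filter prime? l)) (sym (upTo-∷ʳ (suc x))) ⟩
    length (filter prime? (upTo (suc x) ++ [ suc x ]))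
  ≡⟨ cong length (filter-++ prime? (upTo (suc x)) [ suc x ]) ⟩
    length (filter prime? (upTo (suc x)) ++ filter prime? [ suc x ])
  ≡⟨ length-++ (filter prime? (upTo (suc x))) ⟩
    primePi x + length (filter prime? [ suc x ])
  ∎ where open ≡-Reasoning

primePi-suc-prime : ∀ {x} → Prime (suc x) → primePi (suc x) ≡ suc (primePi x)
primePi-suc-prime {x} px with prime? (suc x) | primePi-suc x
... | yes _ | eq = trans eq (+-comm (primePi x) 1)
... | no ¬px | _ = contradiction px ¬px

primePi-≤-suc : ∀ x → primePi x ≤ primePi (suc x)
primePi-≤-suc x rewrite primePi-suc x = m≤m+n _ _

primePi-mono-≤ : ∀ {x y} → x ≤ y → primePi x ≤ primePi y
primePi-mono-≤ {y = zero} x≤0 rewrite n≤0⇒n≡0 x≤0 = ≤-refl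
primePi-mono-≤ {y = suc y} x≤1+y with m≤n⇒m<n∨m≡n x≤1+y
... | inj₁ (s≤s x≤y) = ≤-trans (primePi-mono-≤ x≤y) (primePi-≤-suc y)
... | inj₂ refl = ≤-refl

primePi-<-prime : ∀ {y x} → y < x → Prime x → primePi y < primePi x
primePi-<-prime {x = suc x} (s≤s y≤x) px rewrite primePi-suc-prime px = s≤s (primePi-mono-≤ y≤x)

primePi-between-consecutive : ∀ {n p q x} → IsNthPrime n p → IsNthPrime (suc n) q →
                              p ≤ x → x < q → primePi x ≡ n
primePi-between-consecutive {n} {p} {suc q} {x} (_ , πp≡n) (pq , πq≡1+n) p≤x (s≤s x≤q) =
  ≤-antisym
    (s≤s⁻¹ (begin
      suc (primePi x) ≤⟨ s≤s (primePi-mono-≤ x≤q) ⟩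
      suc (primePi q) ≡⟨ sym (primePi-suc-prime pq) ⟩
      primePi (suc q) ≡⟨ πq≡1+n ⟩
      suc n           ∎))
    (subst (_≤ primePi x) πp≡n (primePi-mono-≤ p≤x))
  where open ≤-Reasoning

ramanujan-fails-below : ∀ {m r} → IsRamanujan m (suc r) → 1 ≤ r → ¬ RamanujanCond m r
ramanujan-fails-below {r = r} (_ , good , minimal) 1≤r cond = minimal r 1≤r (n<1+n r) goodFrom-r
  where
  goodFrom-r : GoodFrom _ r
  goodFrom-r x r≤x with m≤n⇒m<n∨m≡n r≤x
  ... | inj₁ r<x = good x r<x
  ... | inj₂ refl = cond

prime-1+2t⇒t>0 : ∀ {t} → Prime (suc (t * 2)) → 0 < t
prime-1+2t⇒t>0 {zero} ()
prime-1+2t⇒t>0 {suc _} _ = z<s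

oddRamanujanPrime-primePi-≤ : ∀ {m t} → IsRamanujan m (suc (t * 2)) → Prime (suc (t * 2)) →
                              primePi (suc (t * 2)) ≤ m + primePi t
oddRamanujanPrime-primePi-≤ {m} {t} ram pt =
  subst₂ (λ a b → a ≤ m + primePi b) (sym (primePi-suc-prime pt)) (m*n/n≡m t 2)
    (≰⇒> (ramanujan-fails-below ram (≤-trans (prime-1+2t⇒t>0 pt) (m≤m*n t 2))))

composite-after-oddRamanujanPrime : ∀ {m n t q k} →
    IsRamanujan m (suc (t * 2)) → IsNthPrime n (suc (t * 2)) → IsNthPrime (suc n) q →
    t < k → k * 2 < q → Composite k
composite-after-oddRamanujanPrime {m} {n} {t} {q} {k} ram@(_ , good , _) np@(pp , πp≡n) nq t<k 2k<q =
  ¬prime⇒composite {{n>1⇒nonTrivial (<-≤-trans (s≤s (prime-1+2t⇒t>0 pp)) t<k)}} ¬pk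
  where
  p≤2k : suc (t * 2) ≤ k * 2
  p≤2k = ≤-trans (n≤1+n (suc (t * 2))) (*-monoˡ-≤ 2 t<k)

  condAt2k : m + primePi k ≤ n
  condAt2k = subst₂ (λ a b → m + primePi a ≤ b) (m*n/n≡m k 2)
               (primePi-between-consecutive np nq p≤2k 2k<q)
               (good (k * 2) p≤2k)

  ¬pk : ¬ Prime k
  ¬pk pk = <⇒≱ (primePi-<-prime t<k pk) (+-cancelˡ-≤ m _ _ (begin
    m + primePi k          ≤⟨ condAt2k ⟩
    n                      ≡⟨ sym πp≡n ⟩
    primePi (suc (t * 2))  ≤⟨ oddRamanujanPrime-primePi-≤ {t = t} ram pp ⟩
    m + primePi t          ∎))
    where open ≤-Reasoning

odd⇒≡1+half*2 : ∀ {p} → Odd p → p ≡ suc (p / 2 * 2)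
odd⇒≡1+half*2 {p} odd = trans (m≡m%n+[m/n]*n p 2) (cong (_+ p / 2 * 2) odd)

[1+t*2+1]/2≡1+t : ∀ t → (suc (t * 2) + 1) / 2 ≡ suc t
[1+t*2+1]/2≡1+t t = trans (cong (_/ 2) (+-comm (suc (t * 2)) 1)) (m*n/n≡m (suc t) 2)

lemma2 : (n p q : ℕ) → IsRamanujanPrime p → Odd p →
    IsNthPrime n p → IsNthPrime (suc n) q →
    (k : ℕ) → (p + 1) / 2 ≤ k → k ≤ (q ∸ 1) / 2 → Composite k
lemma2 n p q (m , _ , ram) odd np nq@(pq , _) k lo hi =
  composite-after-oddRamanujanPrime (subst (IsRamanujan m) p≡1+2t ram)
    (subst (IsNthPrime n) p≡1+2t np) nq t<k 2k<q
  where
  t : ℕ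
  t = p / 2

  p≡1+2t : p ≡ suc (t * 2)
  p≡1+2t = odd⇒≡1+half*2 odd

  t<k : t < k
  t<k = subst (_≤ k) ([1+t*2+1]/2≡1+t t) (subst (λ z → (z + 1) / 2 ≤ k) p≡1+2t lo)

  2k<q : k * 2 < q
  2k<q = ≤-<-trans (≤-trans (*-monoˡ-≤ 2 hi) (m/n*n≤m (q ∸ 1) 2)) (prime⇒pred< q pq)
    where
    prime⇒pred< : ∀ x → Prime x → x ∸ 1 < x
    prime⇒pred< (suc x) _ = n<1+n x
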